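{- Let $\mathbf A=(A;w^{\mathbf A})$ where $w^{\mathbf A}$ is an $n$-ary idempotent operation, and suppose $0_{\mathbf A}$ is a perfect linear congruence witnessed by $\zeta\le\mathbf A\times\mathbf A\times\mathbf Z_p$. Then: (1) for every $(a,b)\in 0_{\mathbf A}^*$ there is a unique $c$ with $(a,b,c)\in\zeta$; (2) $n-1$ is divisible by $p$; (3) $w^{\mathbf A}(a,\dots,a,b,a,\dots,a)=b$ for every $(a,b)\in0_{\mathbf A}^*$ and any position of $b$; (4) for every $a\in A$ and $c\in\mathbb Z_p$ there is at most one $b\in A$ with $(a,b,c)\in\zeta$; (5) for every $b\in A$ and $c\in\mathbb Z_p$ there is at most one $a\in A$ with $(a,b,c)\in\zeta$; (6) if $(a,b,d),(b,c,e)\in\zeta$ then $(a,c,d+e)\in\zeta$.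
   Context: $0_{\mathbf A}$ is the equality relation on $A$. $\mathbf Z_p$ is the algebra on $\{0,\dots,p-1\}$ with $n$-ary operation $y_1+\dots+y_n\pmod p$. $0_{\mathbf A}$ is irreducible if it is not the intersection of subalgebras of $\mathbf A\times\mathbf A$ each different from $0_{\mathbf A}$; in that case $0_{\mathbf A}^*$ denotes the minimal subalgebra of $\mathbf A\times\mathbf A$ properly containing $0_{\mathbf A}$. $0_{\mathbf A}$ is a perfect linear congruence if it is irreducible and there exists a subalgebra $\zeta\le\mathbf A\times\mathbf A\times\mathbf Z_p$ ($p$ prime) with projection onto the first two coordinates equal to $0_{\mathbf A}^*$ and such that $(a_1,a_2,b)\in\zeta$ implies ($a_1=a_2\iff b=0$). -}

module Defs where

open import Data.Nat using (ℕ; zero; suc; _+_; NonZero)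
open import Data.Nat.DivMod using (_mod_)
open import Data.Fin using (Fin; toℕ; _≟_)
import Data.Fin as F
open import Data.Bool using (if_then_else_)
open import Data.Product using (Σ; ∃; _×_; _,_)
open import Relation.Nullary using (¬_)
open import Relation.Nullary.Decidable using (⌊_⌋)
open import Relation.Binary.PropositionalEquality using (_≡_)

Op : ℕ → Set → Set
Op n A = (Fin n → A) → A

Idempotent : ∀ {n} {A : Set} → Op n A → Set
Idempotent {A = A} w = ∀ (a : A) → w (λ _ → a) ≡ a

Rel₂ : Set → Set₁
Rel₂ A = A → A → Set

IsSubalg₂ : ∀ {n} {A : Set} → Op n A → Rel₂ A → Set
IsSubalg₂ {n} {A} w S =
  ∀ (x y : Fin n → A) → (∀ i → S (x i) (y i)) → S (w x) (w y)

DiffersFrom0 : ∀ {A : Set} → Rel₂ A → Set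
DiffersFrom0 {A} S = ¬ (∀ (a b : A) → (S a b → a ≡ b) × (a ≡ b → S a b))

Irreducible : ∀ {n} {A : Set} → Op n A → Set₁
Irreducible {n} {A} w =
  ∀ (I : Set) (S : I → Rel₂ A) →
    (∀ i → IsSubalg₂ w (S i)) →
    (∀ i → DiffersFrom0 (S i)) →
    ¬ (∀ (a b : A) → ((∀ i → S i a b) → a ≡ b) × (a ≡ b → ∀ i → S i a b))

ProperlyContains0 : ∀ {A : Set} → Rel₂ A → Set
ProperlyContains0 {A} S = (∀ (a : A) → S a a) × Σ A (λ a → Σ A (λ b → S a b × ¬ a ≡ b))

-- 0_A^* : the intersection of all subalgebras of A × A properly containing 0_A
-- (when 0_A is irreducible this is the minimal such subalgebra).
ZeroStar : ∀ {n} {A : Set} → Op n A → A → A → Set₁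
ZeroStar {n} {A} w a b =
  ∀ (S : Rel₂ A) → IsSubalg₂ w S → ProperlyContains0 S → S a b

-- Z_p : the n-ary operation y₁ + ... + yₙ (mod p) on Fin p.
sumℕ : ∀ {n} → (Fin n → ℕ) → ℕ
sumℕ {zero} f = 0
sumℕ {suc n} f = f F.zero + sumℕ (λ i → f (F.suc i))

zsum : ∀ {n} (p : ℕ) .{{_ : NonZero p}} → (Fin n → Fin p) → Fin p
zsum p y = sumℕ (λ i → toℕ (y i)) mod p

addZ : (p : ℕ) .{{_ : NonZero p}} → Fin p → Fin p → Fin p
addZ p d e = (toℕ d + toℕ e) mod p

IsSubalg₃ : ∀ {n} {A : Set} → Op n A → (p : ℕ) .{{_ : NonZero p}} →
            (A → A → Fin p → Set) → Set
IsSubalg₃ {n} {A} w p ζ =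
  ∀ (x y : Fin n → A) (z : Fin n → Fin p) →
    (∀ i → ζ (x i) (y i) (z i)) → ζ (w x) (w y) (zsum p z)

-- ζ witnesses that 0_A is a perfect linear congruence (p prime is required separately).
PerfectLinearWitness : ∀ {n} {A : Set} → Op n A → (p : ℕ) .{{_ : NonZero p}} →
                       (A → A → Fin p → Set) → Set₁
PerfectLinearWitness {n} {A} w p ζ =
  Irreducible w
  × IsSubalg₃ w p ζ
  × (∀ (a b : A) → ((∃ λ c → ζ a b c) → ZeroStar w a b)
                 × (ZeroStar w a b → ∃ λ c → ζ a b c))
  × (∀ (a₁ a₂ : A) (c : Fin p) → ζ a₁ a₂ c →
       (a₁ ≡ a₂ → toℕ c ≡ 0) × (toℕ c ≡ 0 → a₁ ≡ a₂))

oneAt : ∀ {n} {A : Set} → Fin n → A → A → Fin n → A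
oneAt i a b j = if ⌊ j ≟ i ⌋ then b else a

{-# OPTIONS --safe #-}
-- Fix a ≢ b. By idempotence the labels C = {c ∣ ζ a b c} ⊆ ℤ_p are closed under n-ary sums,
-- and 0 ∉ C. For c, e ∈ C, applying w to labels (f, e, c, …, c) shows that C is closed under
-- translation by e + (n − 2)c; since p is prime, a nonzero step would carry c to 0. Hence
-- e + (n − 2)c ≡ 0 for all c, e ∈ C: with e = c this gives p ∣ n − 1 (irreducibility provides
-- some a ≢ b related by 0_A*), and then e ≡ c. Applying w to the edges (b, a, c̄) everywhere
-- except (b, b, 0) at position i gives labels summing to (n − 1)c̄ ≡ 0, whence (3); applying w
-- to (a, b, d), (b, c, e), (b, b, 0), … and using (3) gives (6); and (4), (5) follow from (6) by
-- composing with a reverse edge. In arity ≤ 1, ζ makes w respect equality, so A is trivial or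
-- w is a projection, and either way 0_A is not irreducible.
module Submission where

open import Defs
open import Data.Nat using (ℕ; NonZero; _∸_)
open import Data.Nat.Divisibility using (_∣_)
open import Data.Nat.Primality using (Prime)
open import Data.Fin using (Fin)
open import Data.Product using (Σ; _×_)
open import Relation.Binary.PropositionalEquality using (_≡_)

open import Algebra.Properties.CommutativeSemigroup as CSProperties using ()
open import Data.Nat using (zero; suc; _+_; _*_; _%_; _≤_; _<_)
open import Data.Nat.Properties
  using (+-assoc; +-identityʳ; *-assoc; ≤-total; ≤-antisym; ≤-<-trans; m∸n≤m; m∸n≡0⇒m≤n;
         m+[n∸m]≡n; +-commutativeSemigroup)
open import Data.Nat.DivMod using (_mod_; %-distribˡ-+; m%n%n≡m%n; m<n⇒m%n≡m)
open import Data.Nat.Divisibility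
  using (divides; _∣?_; _∣0; n∣m⇒m%n≡0; ∣m+n∣m⇒∣n; ∣m⇒∣m*n; ∣n⇒∣m*n; >⇒∤)
open import Data.Nat.Primality using (euclidsLemma; prime⇒irreducible; prime⇒nonZero)
open import Data.Nat.Coprimality using (Coprime; coprime-Bézout)
open import Data.Nat.GCD using (module Bézout)
open import Data.Nat.Tactic.RingSolver using (solve)
open import Data.List using ([]; _∷_)
import Data.Fin as F
open import Data.Fin.Properties using (toℕ-injective; toℕ-fromℕ<; fromℕ<-cong; toℕ<n)
open import Data.Product using (_,_; proj₁; proj₂; ∃)
open import Data.Sum using (_⊎_; inj₁; inj₂; [_,_]′)
open import Data.Empty using (⊥-elim)
open import Function using (id; _∘_)
open import Relation.Nullary using (¬_; yes; no; contradiction)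
open import Relation.Nullary.Decidable using (decidable-stable)
open import Relation.Binary.Definitions using (DecidableEquality)
open import Relation.Binary.PropositionalEquality
  using (_≢_; refl; sym; trans; cong; cong₂; subst; subst₂; module ≡-Reasoning)

open F using (toℕ)
open CSProperties +-commutativeSemigroup using (x∙yz≈y∙xz; xy∙z≈xz∙y)
open ≡-Reasoning

sumℕ-cong : ∀ {k} {f g : Fin k → ℕ} → (∀ j → f j ≡ g j) → sumℕ f ≡ sumℕ g
sumℕ-cong {zero}  f≗g = refl
sumℕ-cong {suc k} f≗g = cong₂ _+_ (f≗g F.zero) (sumℕ-cong (f≗g ∘ F.suc))

sumℕ-const : ∀ k v → sumℕ {k} (λ _ → v) ≡ k * v
sumℕ-const zero    v = refl
sumℕ-const (suc k) v = cong (v +_) (sumℕ-const k v)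

sumℕ-zeros : ∀ k → sumℕ {k} (λ _ → 0) ≡ 0
sumℕ-zeros zero    = refl
sumℕ-zeros (suc k) = sumℕ-zeros k

oneAt-suc : ∀ {n} {A : Set} {i j : Fin n} {a b : A} →
            oneAt (F.suc i) a b (F.suc j) ≡ oneAt i a b j
oneAt-suc {i = i} {j} with j F.≟ i
... | yes _ = refl
... | no _  = refl

oneAt-pointwise : ∀ {n} {A B : Set} (R : A → B → Set) (i : Fin n) {a b : A} {c d : B} →
                  R a c → R b d → ∀ j → R (oneAt i a b j) (oneAt i c d j)
oneAt-pointwise R i Rac Rbd j with j F.≟ i
... | yes _ = Rbd
... | no _  = Rac

sumℕ-oneAt : ∀ {A : Set} {k} (f : A → ℕ) (i : Fin (suc k)) (a b : A) →
             sumℕ (λ j → f (oneAt i a b j)) ≡ f b + k * f a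
sumℕ-oneAt {k = k} f F.zero a b = cong (f b +_) (sumℕ-const k (f a))
sumℕ-oneAt {k = suc k} f (F.suc i) a b = begin
  f a + sumℕ (λ j → f (oneAt (F.suc i) a b (F.suc j)))
    ≡⟨ cong (f a +_) (sumℕ-cong (λ j → cong f (oneAt-suc {i = i} {j} {a} {b}))) ⟩
  f a + sumℕ (λ j → f (oneAt i a b j))
    ≡⟨ cong (f a +_) (sumℕ-oneAt f i a b) ⟩
  f a + (f b + k * f a)
    ≡⟨ x∙yz≈y∙xz (f a) (f b) (k * f a) ⟩
  f b + (f a + k * f a) ∎

toℕ-mod : ∀ u p .{{_ : NonZero p}} → toℕ (u mod p) ≡ u % p
toℕ-mod u p = toℕ-fromℕ< _

mod-cong : ∀ u v p .{{_ : NonZero p}} → u % p ≡ v % p → u mod p ≡ v mod p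
mod-cong u v p eq = fromℕ<-cong _ _ eq _ _

toℕ-mod-toℕ : ∀ {p} .{{_ : NonZero p}} (c : Fin p) → toℕ c mod p ≡ c
toℕ-mod-toℕ {p} c = toℕ-injective (trans (toℕ-mod (toℕ c) p) (m<n⇒m%n≡m (toℕ<n c)))

[m%n+o]%n≡[m+o]%n : ∀ m o n .{{_ : NonZero n}} → (m % n + o) % n ≡ (m + o) % n
[m%n+o]%n≡[m+o]%n m o n = begin
  (m % n + o) % n          ≡⟨ %-distribˡ-+ (m % n) o n ⟩
  (m % n % n + o % n) % n  ≡⟨ cong (λ t → (t + o % n) % n) (m%n%n≡m%n m n) ⟩
  (m % n + o % n) % n      ≡⟨ %-distribˡ-+ m o n ⟨
  (m + o) % n              ∎

zsum≡0 : ∀ {k} p .{{_ : NonZero p}} (z : Fin k → Fin p) → p ∣ sumℕ (toℕ ∘ z) → toℕ (zsum p z) ≡ 0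
zsum≡0 p z p∣Σz = trans (toℕ-mod _ p) (n∣m⇒m%n≡0 _ p p∣Σz)

∣∧<⇒≡0 : ∀ {d n} → d ∣ n → n < d → n ≡ 0
∣∧<⇒≡0 {n = zero}  _   _   = refl
∣∧<⇒≡0 {n = suc _} d∣n n<d = contradiction d∣n (>⇒∤ n<d)

∣m+o∧∣n+o⇒n≤m : ∀ {d m n o} → m ≤ n → n < d → d ∣ m + o → d ∣ n + o → n ≤ m
∣m+o∧∣n+o⇒n≤m {d} {m} {n} {o} m≤n n<d d∣m+o d∣n+o =
  m∸n≡0⇒m≤n (∣∧<⇒≡0 d∣n∸m (≤-<-trans (m∸n≤m n m) n<d))
  where
  n+o≡m+o+[n∸m] : n + o ≡ m + o + (n ∸ m)
  n+o≡m+o+[n∸m] = sym (trans (xy∙z≈xz∙y m o (n ∸ m)) (cong (_+ o) (m+[n∸m]≡n m≤n)))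
  d∣n∸m : d ∣ n ∸ m
  d∣n∸m = ∣m+n∣m⇒∣n (subst (d ∣_) n+o≡m+o+[n∸m] d∣n+o) d∣m+o

∣m+o∧∣n+o⇒m≡n : ∀ {d m n o} → m < d → n < d → d ∣ m + o → d ∣ n + o → m ≡ n
∣m+o∧∣n+o⇒m≡n {m = m} {n} m<d n<d d∣m+o d∣n+o with ≤-total m n
... | inj₁ m≤n = ≤-antisym m≤n (∣m+o∧∣n+o⇒n≤m m≤n n<d d∣m+o d∣n+o)
... | inj₂ n≤m = ≤-antisym (∣m+o∧∣n+o⇒n≤m n≤m m<d d∣n+o d∣m+o) n≤m

iterate-+ : ∀ (Q : ℕ → Set) {d} → (∀ u → Q u → Q (u + d)) → ∀ i u → Q u → Q (u + i * d)
iterate-+ Q step zero    u Qu = subst Q (sym (+-identityʳ u)) Qu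
iterate-+ Q step (suc i) u Qu = subst Q (+-assoc u _ _) (iterate-+ Q step i (u + _) (step u Qu))

prime∤⇒coprime : ∀ {p d} → Prime p → ¬ p ∣ d → Coprime p d
prime∤⇒coprime p-prime p∤d (k∣p , k∣d) with prime⇒irreducible p-prime k∣p
... | inj₁ k≡1 = k≡1
... | inj₂ refl = contradiction k∣d p∤d

prime∤⇒∃i-p∣x+i*d : ∀ {p d} → Prime p → ¬ p ∣ d → ∀ x → ∃ λ i → p ∣ x + i * d
prime∤⇒∃i-p∣x+i*d {zero} p-prime with () ← prime⇒nonZero p-prime
prime∤⇒∃i-p∣x+i*d {p@(suc q)} {d} p-prime p∤d x with coprime-Bézout (prime∤⇒coprime p-prime p∤d)
... | Bézout.+- s t 1+td≡sp = x * t , divides (x * s) (begin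
  x + x * t * d    ≡⟨ solve (x ∷ t ∷ d ∷ []) ⟩
  x * (1 + t * d)  ≡⟨ cong (x *_) 1+td≡sp ⟩
  x * (s * p)      ≡⟨ *-assoc x s p ⟨
  x * s * p        ∎)
-- t inverts d modulo p, and q = p − 1 ≡ −1.
... | Bézout.-+ s t 1+sp≡td = x * t * q , divides (x + x * q * s) (begin
  x + x * t * q * d      ≡⟨ solve (x ∷ t ∷ q ∷ d ∷ []) ⟩
  x + x * q * (t * d)    ≡⟨ cong (λ y → x + x * q * y) 1+sp≡td ⟨
  x + x * q * (1 + s * p) ≡⟨ solve (x ∷ q ∷ s ∷ []) ⟩
  (x + x * q * s) * p    ∎)

module _ {n} {A : Set} {w : Op n A} where

  0*-refl : ∀ a → ZeroStar w a a
  0*-refl a S _ (S-refl , _) = S-refl a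

  0*-sym : ∀ {a b} → ZeroStar w a b → ZeroStar w b a
  0*-sym 0*ab S S-sub (S-refl , u , v , Suv , u≢v) =
    0*ab (λ x y → S y x) (λ x y Sxy → S-sub y x Sxy) (S-refl , v , u , Suv , u≢v ∘ sym)

  data Generated (a b : A) : A → A → Set where
    diagonal  : ∀ u → Generated a b u u
    generator : Generated a b a b
    closed    : ∀ x y → (∀ i → Generated a b (x i) (y i)) → Generated a b (w x) (w y)

  Generated-least : ∀ {a b} {S : Rel₂ A} → IsSubalg₂ w S → (∀ u → S u u) → S a b →
                    ∀ {u v} → Generated a b u v → S u v
  Generated-least S-sub S-refl Sab (diagonal u)   = S-refl u
  Generated-least S-sub S-refl Sab generator      = Sab
  Generated-least S-sub S-refl Sab (closed x y G) = S-sub x y (λ i → Generated-least S-sub S-refl Sab (G i))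

  -- 0_A* is the intersection of the subalgebras generated by 0_A and a single pair a ≢ b.
  irreducible⇒0*⊈≡ : Irreducible w → ¬ (∀ a b → ZeroStar w a b → a ≡ b)
  irreducible⇒0*⊈≡ irr 0*⊆≡ = irr I S (λ _ → closed) S≢0 ⋂S≡0
    where
    I : Set
    I = Σ A λ a → Σ A λ b → a ≢ b
    S : I → Rel₂ A
    S (a , b , _) = Generated a b
    S≢0 : ∀ i → DiffersFrom0 (S i)
    S≢0 (a , b , a≢b) S≡0 = a≢b (proj₁ (S≡0 a b) generator)
    ⋂S⊆0* : ∀ {u v} → (∀ i → S i u v) → ZeroStar w u v
    ⋂S⊆0* Suv T T-sub (T-refl , a , b , Tab , a≢b) = Generated-least T-sub T-refl Tab (Suv (a , b , a≢b))
    ⋂S≡0 : ∀ u v → ((∀ i → S i u v) → u ≡ v) × (u ≡ v → ∀ i → S i u v)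
    ⋂S≡0 u v = 0*⊆≡ u v ∘ ⋂S⊆0* , λ { refl i → diagonal u }

nullary-¬irreducible : ∀ {A : Set} (w : Op 0 A) → Idempotent w → IsSubalg₂ w _≡_ → ¬ Irreducible w
nullary-¬irreducible w idem ≡-isSubalg irr = irreducible⇒0*⊈≡ irr λ a b _ → begin
  a            ≡⟨ idem a ⟨
  w (λ _ → a)  ≡⟨ ≡-isSubalg _ _ (λ ()) ⟩
  w (λ _ → b)  ≡⟨ idem b ⟩
  b            ∎

unary-¬irreducible : ∀ {A : Set} → DecidableEquality A →
                     (w : Op 1 A) → Idempotent w → IsSubalg₂ w _≡_ → ¬ Irreducible w
unary-¬irreducible {A} _≟_ w idem ≡-isSubalg irr = irreducible⇒0*⊈≡ irr 0*⊆≡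
  where
  w-projection : ∀ x → w x ≡ x F.zero
  w-projection x = trans (≡-isSubalg x (λ _ → x F.zero) λ { F.zero → refl }) (idem (x F.zero))
  0*⊆≡ : ∀ a b → ZeroStar w a b → a ≡ b
  0*⊆≡ a b 0*ab with a ≟ b
  ... | yes a≡b = a≡b
  ... | no a≢b  =
    [ id , proj₁ ]′ (0*ab S S-sub ((λ _ → inj₁ refl) , b , a , inj₂ (refl , refl) , a≢b ∘ sym))
    where
    S : Rel₂ A
    S u v = u ≡ v ⊎ (u ≡ b × v ≡ a)
    S-sub : IsSubalg₂ w S
    S-sub x y Sxy = subst₂ S (sym (w-projection x)) (sym (w-projection y)) (Sxy F.zero)

module PerfectLinear {A : Set} {n} (w : Op n A) (idem : Idempotent w)
                     (q : ℕ) (ζ : A → A → Fin (suc q) → Set)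
                     (perfect : PerfectLinearWitness w (suc q) ζ) where

  -- p is passed as suc q so that F.zero : Fin p.
  p : ℕ
  p = suc q

  ζ-isSubalg : IsSubalg₃ w p ζ
  ζ-isSubalg = proj₁ (proj₂ perfect)

  ζ⇒0* : ∀ {a b c} → ζ a b c → ZeroStar w a b
  ζ⇒0* ζabc = proj₁ (proj₁ (proj₂ (proj₂ perfect)) _ _) (_ , ζabc)

  0*⇒ζ : ∀ {a b} → ZeroStar w a b → ∃ (ζ a b)
  0*⇒ζ = proj₂ (proj₁ (proj₂ (proj₂ perfect)) _ _)

  ζ-≡⇒0 : ∀ {a b c} → ζ a b c → a ≡ b → toℕ c ≡ 0
  ζ-≡⇒0 ζabc = proj₁ (proj₂ (proj₂ (proj₂ perfect)) _ _ _ ζabc)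

  ζ-0⇒≡ : ∀ {a b c} → ζ a b c → toℕ c ≡ 0 → a ≡ b
  ζ-0⇒≡ ζabc = proj₂ (proj₂ (proj₂ (proj₂ perfect)) _ _ _ ζabc)

  ζ-refl : ∀ a → ζ a a F.zero
  ζ-refl a = let _ , ζaac = 0*⇒ζ (0*-refl a) in subst (ζ a a) (toℕ-injective (ζ-≡⇒0 ζaac refl)) ζaac

  ζ-flip : ∀ {a b c} → ζ a b c → ∃ (ζ b a)
  ζ-flip = 0*⇒ζ ∘ 0*-sym ∘ ζ⇒0*

  ζ-closed : ∀ {a b} (z : Fin n → Fin p) → (∀ i → ζ a b (z i)) → ζ a b (zsum p z)
  ζ-closed {a} {b} z ζabz =
    subst₂ (λ x y → ζ x y (zsum p z)) (idem a) (idem b) (ζ-isSubalg (λ _ → a) (λ _ → b) z ζabz)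

  ≡-isSubalg : IsSubalg₂ w _≡_
  ≡-isSubalg x y x≗y =
    ζ-0⇒≡ (ζ-isSubalg x y zeros ζxy0) (zsum≡0 p zeros (subst (p ∣_) (sym (sumℕ-zeros n)) (p ∣0)))
    where
    zeros : Fin n → Fin p
    zeros _ = F.zero
    ζxy0 : ∀ i → ζ (x i) (y i) F.zero
    ζxy0 i = subst (λ y → ζ (x i) y F.zero) (x≗y i) (ζ-refl (x i))

module AtLeastBinary {A : Set} {r} (w : Op (2 + r) A) (idem : Idempotent w)
                     (q : ℕ) (p-prime : Prime (suc q)) (ζ : A → A → Fin (suc q) → Set)
                     (perfect : PerfectLinearWitness w (suc q) ζ) where

  open PerfectLinear w idem q ζ perfect public

  ζℕ : A → A → ℕ → Set
  ζℕ a b u = ζ a b (u mod p)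

  ζ⇒ζℕ : ∀ {a b c} → ζ a b c → ζℕ a b (toℕ c)
  ζ⇒ζℕ {a} {b} {c} = subst (ζ a b) (sym (toℕ-mod-toℕ c))

  ζℕ-shift : ∀ {a b c e} → ζ a b c → ζ a b e →
             ∀ u → ζℕ a b u → ζℕ a b (u + (toℕ e + r * toℕ c))
  ζℕ-shift {a} {b} {c} {e} ζabc ζabe u ζabu =
    subst (ζ a b) (mod-cong (sumℕ (toℕ ∘ z)) (u + (toℕ e + r * toℕ c)) p Σz%p) (ζ-closed z ζabz)
    where
    z : Fin (2 + r) → Fin p
    z F.zero             = u mod p
    z (F.suc F.zero)     = e
    z (F.suc (F.suc _)) = c
    ζabz : ∀ i → ζ a b (z i)
    ζabz F.zero             = ζabu
    ζabz (F.suc F.zero)     = ζabe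
    ζabz (F.suc (F.suc _)) = ζabc
    Σz%p : sumℕ (toℕ ∘ z) % p ≡ (u + (toℕ e + r * toℕ c)) % p
    Σz%p = begin
      (toℕ (u mod p) + (toℕ e + sumℕ {r} (λ _ → toℕ c))) % p
        ≡⟨ cong (λ s → (toℕ (u mod p) + (toℕ e + s)) % p) (sumℕ-const r (toℕ c)) ⟩
      (toℕ (u mod p) + (toℕ e + r * toℕ c)) % p
        ≡⟨ cong (λ t → (t + (toℕ e + r * toℕ c)) % p) (toℕ-mod u p) ⟩
      (u % p + (toℕ e + r * toℕ c)) % p
        ≡⟨ [m%n+o]%n≡[m+o]%n u _ p ⟩
      (u + (toℕ e + r * toℕ c)) % p ∎

  -- Otherwise iterating ζℕ-shift from toℕ c reaches a multiple of p, forcing a ≡ b and c = e = 0.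
  ζ-balanced : ∀ {a b c e} → ζ a b c → ζ a b e → p ∣ toℕ e + r * toℕ c
  ζ-balanced {a} {b} {c} {e} ζabc ζabe = decidable-stable (p ∣? _) λ p∤ →
    let i , p∣c+i* = prime∤⇒∃i-p∣x+i*d p-prime p∤ (toℕ c)
        ζab-hit    = iterate-+ (ζℕ a b) (ζℕ-shift ζabc ζabe) i (toℕ c) (ζ⇒ζℕ ζabc)
        a≡b        = ζ-0⇒≡ ζab-hit (trans (toℕ-mod (toℕ c + i * _) p) (n∣m⇒m%n≡0 _ p p∣c+i*))
    in p∤ (subst₂ (λ x y → p ∣ x + r * y) (sym (ζ-≡⇒0 ζabe a≡b)) (sym (ζ-≡⇒0 ζabc a≡b))
                  (∣n⇒∣m*n r (p ∣0)))

  p∣1+r : p ∣ suc r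
  p∣1+r = decidable-stable (p ∣? suc r) λ p∤1+r → irreducible⇒0*⊈≡ (proj₁ perfect) λ a b 0*ab →
    let c , ζabc = 0*⇒ζ 0*ab
    in [ ⊥-elim ∘ p∤1+r , (λ p∣c → ζ-0⇒≡ ζabc (∣∧<⇒≡0 p∣c (toℕ<n c))) ]′
         (euclidsLemma (suc r) (toℕ c) p-prime (ζ-balanced ζabc ζabc))

  ζ-functional : ∀ {a b c c′} → ζ a b c → ζ a b c′ → c ≡ c′
  ζ-functional {c = c} {c′} ζabc ζabc′ =
    toℕ-injective
      (∣m+o∧∣n+o⇒m≡n (toℕ<n c) (toℕ<n c′) (ζ-balanced ζabc ζabc) (ζ-balanced ζabc ζabc′))

  w-oneAt : ∀ {a b} → ZeroStar w a b → ∀ i → w (oneAt i a b) ≡ b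
  w-oneAt {a} {b} 0*ab i = sym (ζ-0⇒≡ ζbw (zsum≡0 p z p∣Σz))
    where
    c̄ : Fin p
    c̄ = proj₁ (0*⇒ζ (0*-sym 0*ab))
    ζbac̄ : ζ b a c̄
    ζbac̄ = proj₂ (0*⇒ζ (0*-sym 0*ab))
    z : Fin (2 + r) → Fin p
    z = oneAt i c̄ F.zero
    ζbw : ζ b (w (oneAt i a b)) (zsum p z)
    ζbw = subst (λ x → ζ x (w (oneAt i a b)) (zsum p z)) (idem b)
            (ζ-isSubalg (λ _ → b) (oneAt i a b) z (oneAt-pointwise (ζ b) i ζbac̄ (ζ-refl b)))
    p∣Σz : p ∣ sumℕ (toℕ ∘ z)
    p∣Σz = subst (p ∣_) (sym (sumℕ-oneAt toℕ i c̄ F.zero)) (∣m⇒∣m*n (toℕ c̄) p∣1+r)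

  ζ-trans : ∀ {a b c d e} → ζ a b d → ζ b c e → ζ a c (addZ p d e)
  ζ-trans {a} {b} {c} {d} {e} ζabd ζbce =
    subst (ζ a c) Σz≡d+e
      (subst₂ (λ x y → ζ x y (zsum p z))
              (w-oneAt (0*-sym (ζ⇒0* ζabd)) F.zero) (w-oneAt (ζ⇒0* ζbce) (F.suc F.zero))
        (ζ-isSubalg (oneAt F.zero b a) (oneAt (F.suc F.zero) b c) z ζz))
    where
    z : Fin (2 + r) → Fin p
    z F.zero             = d
    z (F.suc F.zero)     = e
    z (F.suc (F.suc _)) = F.zero
    ζz : ∀ j → ζ (oneAt F.zero b a j) (oneAt (F.suc F.zero) b c j) (z j)
    ζz F.zero             = ζabd
    ζz (F.suc F.zero)     = ζbce
    ζz (F.suc (F.suc _)) = ζ-refl b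
    Σz≡d+e : zsum p z ≡ addZ p d e
    Σz≡d+e = cong (λ s → (toℕ d + s) mod p)
                  (trans (cong (toℕ e +_) (sumℕ-zeros r)) (+-identityʳ (toℕ e)))

  ζ-injectiveʳ : ∀ {a b b′ c} → ζ a b c → ζ a b′ c → b ≡ b′
  ζ-injectiveʳ ζabc ζab′c =
    let c̄ , ζbac̄ = ζ-flip ζabc
    in ζ-0⇒≡ (ζ-trans ζbac̄ ζab′c) (ζ-≡⇒0 (ζ-trans ζbac̄ ζabc) refl)

  ζ-injectiveˡ : ∀ {a a′ b c} → ζ a b c → ζ a′ b c → a ≡ a′
  ζ-injectiveˡ ζabc ζa′bc =
    let c̄ , ζba′c̄ = ζ-flip ζa′bc
    in ζ-0⇒≡ (ζ-trans ζabc ζba′c̄) (ζ-≡⇒0 (ζ-trans ζa′bc ζba′c̄) refl)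

lemma4p7 : (m n : ℕ) (w : Op n (Fin m)) → Idempotent w →
    (p : ℕ) .{{_ : NonZero p}} → Prime p →
    (ζ : Fin m → Fin m → Fin p → Set) → PerfectLinearWitness w p ζ →
    (∀ a b → ZeroStar w a b →
       Σ (Fin p) (λ c → ζ a b c × (∀ c′ → ζ a b c′ → c′ ≡ c)))
    × (p ∣ n ∸ 1)
    × (∀ a b → ZeroStar w a b → ∀ (i : Fin n) → w (oneAt i a b) ≡ b)
    × (∀ a c b b′ → ζ a b c → ζ a b′ c → b ≡ b′)
    × (∀ b c a a′ → ζ a b c → ζ a′ b c → a ≡ a′)
    × (∀ a b c d e → ζ a b d → ζ b c e → ζ a c (addZ p d e))
lemma4p7 m n w idem zero p-prime ζ perfect with () ← prime⇒nonZero p-prime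
lemma4p7 m zero w idem (suc q) _ ζ perfect =
  ⊥-elim (nullary-¬irreducible w idem (PerfectLinear.≡-isSubalg w idem q ζ perfect) (proj₁ perfect))
lemma4p7 m (suc zero) w idem (suc q) _ ζ perfect =
  ⊥-elim (unary-¬irreducible F._≟_ w idem (PerfectLinear.≡-isSubalg w idem q ζ perfect) (proj₁ perfect))
lemma4p7 m (suc (suc r)) w idem (suc q) p-prime ζ perfect =
    (λ a b 0*ab → let c , ζabc = 0*⇒ζ 0*ab in c , ζabc , λ c′ ζabc′ → ζ-functional ζabc′ ζabc)
  , p∣1+r
  , (λ a b → w-oneAt)
  , (λ a c b b′ → ζ-injectiveʳ)
  , (λ b c a a′ → ζ-injectiveˡ)
  , (λ a b c d e → ζ-trans)
  where open AtLeastBinary w idem q p-prime ζ perfect
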